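{- Let $D=(V,A)$ be a digraph, $k\in\mathbb{N}$, and $\mathcal{B}=(\mathcal{B}_0,\dots,\mathcal{B}_{k-1})$ with $\mathcal{B}_i=(V_i,A_i)$ pairwise edge-disjoint branchings in $D$, such that for every $\varnothing\neq X\subseteq V$, $\varrho_{D\setminus\mathcal{B}}(X)\geq|\{i<k:V_i\cap X=\varnothing\}|$. Let $B$ be a dangerous set. Then for any $w\in B$ there is a path $R$ from $V_0\cap B$ to $w$ in the subdigraph $(D\setminus\mathcal{B})[B]$ spanned by $B$.
   Context: $D\setminus\mathcal{B}=(V,A\setminus\bigcup_{i<k}A_i)$; $\varrho_H(X)$ is the cardinality of the set of edges of $H$ entering $X$. A branching is a digraph whose weakly connected components are arborescences; $V_i$ is the vertex set of $\mathcal{B}_i$. A set $\varnothing\neq X\subseteq V$ is tight if $\varrho_{D\setminus\mathcal{B}}(X)=|\{i<k:V_i\cap X=\varnothing\}|$ and dangerous if it is tight and $X\cap V_0\neq\varnothing$. A path (directed, simple) goes from $X$ to $Y$ if it meets $X$ only in its first vertex and $Y$ only in its last vertex. -}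

module Defs where

open import Data.Nat using (ℕ; zero; suc; _+_; _≤_)
open import Data.Fin using (Fin; zero; suc; inject₁; fromℕ; _≟_)
open import Data.Bool using (Bool; true; false; _∧_; _∨_; not; if_then_else_)
open import Data.Product using (Σ; ∃; _×_; _,_)
open import Relation.Binary.PropositionalEquality using (_≡_; _≢_)
open import Relation.Nullary.Decidable using (⌊_⌋)
open import Relation.Nullary using (¬_)
open import Function.Definitions using (Injective)

-- A finite digraph (parallel arcs and loops allowed): vertices Fin n,
-- arcs Fin m, each arc a goes from tail a to head a.
record Digraph : Set where
  field
    n    : ℕ
    m    : ℕ
    tail : Fin m → Fin n
    head : Fin m → Fin n

Subset : ℕ → Set
Subset k = Fin k → Bool

count : ∀ {k} → Subset k → ℕ
count {zero}  P = 0
count {suc k} P = (if P zero then 1 else 0) + count (λ i → P (suc i))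

anyF : ∀ {k} → Subset k → Bool
anyF {zero}  P = false
anyF {suc k} P = P zero ∨ anyF (λ i → P (suc i))

_==_ : ∀ {k} → Fin k → Fin k → Bool
x == y = ⌊ x ≟ y ⌋

_∈ₛ_ : ∀ {k} → Fin k → Subset k → Set
x ∈ₛ S = S x ≡ true

module _ (D : Digraph) where
  open Digraph D

  record Walk (P : Subset m) (l : ℕ) : Set where
    field
      verts   : Fin (suc l) → Fin n
      arcs    : Fin l → Fin m
      arcTail : ∀ i → tail (arcs i) ≡ verts (inject₁ i)
      arcHead : ∀ i → head (arcs i) ≡ verts (suc i)
      arcsIn  : ∀ i → arcs i ∈ₛ P

  -- A subdigraph (Vs, As) of D is a branching: arcs have endpoints in Vs,
  -- every vertex has in-degree ≤ 1 in As, and As has no directed cycle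
  -- (equivalently: each weakly connected component is an arborescence).
  record IsBranching (Vs : Subset n) (As : Subset m) : Set where
    field
      endpoints : ∀ a → a ∈ₛ As → (tail a ∈ₛ Vs) × (head a ∈ₛ Vs)
      indeg≤1   : ∀ v → count (λ a → As a ∧ (head a == v)) ≤ 1
      acyclic   : ∀ l (W : Walk As (suc l)) →
                    Walk.verts W zero ≢ Walk.verts W (fromℕ (suc l))

  record Branchings (k : ℕ) : Set where
    field
      Vb : Fin k → Subset n
      Ab : Fin k → Subset m
      branching : ∀ i → IsBranching (Vb i) (Ab i)
      edgeDisjoint : ∀ i j → i ≢ j → ∀ a → ¬ (a ∈ₛ Ab i × a ∈ₛ Ab j)

  module _ {k : ℕ} (𝓑 : Branchings k) where
    open Branchings 𝓑

    restArcs : Subset m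
    restArcs a = not (anyF (λ i → Ab i a))

    ϱ : Subset n → ℕ
    ϱ X = count (λ a → restArcs a ∧ (X (head a) ∧ not (X (tail a))))

    missing : Subset n → ℕ
    missing X = count (λ i → not (anyF (λ v → Vb i v ∧ X v)))

    Nonempty : Subset n → Set
    Nonempty X = ∃ λ v → v ∈ₛ X

    Tight : Subset n → Set
    Tight X = Nonempty X × (ϱ X ≡ missing X)

module _ (D : Digraph) {k : ℕ} (𝓑 : Branchings D (suc k)) where
  open Digraph D
  open Branchings 𝓑

  Dangerous : Subset n → Set
  Dangerous X = Tight D 𝓑 X × ∃ λ v → (v ∈ₛ Vb zero) × (v ∈ₛ X)

  -- A (simple, directed) path from V_0 ∩ B to w in (D ∖ 𝓑)[B]:
  -- a walk with pairwise distinct vertices, all arcs in D ∖ 𝓑, all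
  -- vertices in B, starting in V_0 ∩ B, meeting V_0 ∩ B only in its first
  -- vertex, and ending at w (met only at the end, by distinctness).
  record PathIn (B : Subset n) (w : Fin n) : Set where
    field
      len      : ℕ
      walk     : Walk D (restArcs D 𝓑) len
    open Walk walk
    field
      simple   : Injective _≡_ _≡_ verts
      inB      : ∀ j → verts j ∈ₛ B
      start    : verts zero ∈ₛ Vb zero
      startOnly : ∀ j → j ≢ zero → ¬ (verts j ∈ₛ Vb zero)
      end      : verts (fromℕ len) ≡ w

module Submission where

-- Let R ⊆ B be the set of vertices reachable from V₀ ∩ B by a
-- path of D∖𝓑 inside B.  We compute R as the limit of breadth-first layers
--   L₀ = V₀ ∩ B,   L_{t+1} = L_t ∪ { v ∈ B : some arc u→v of D∖𝓑 has u ∈ L_t }.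
-- By induction on t every vertex of L_t is the end of a path (in the sense of
-- PathIn) all of whose vertices lie in L_t: a vertex first appearing in
-- L_{t+1} is appended to a path inside L_t, so the path stays simple.
-- An increasing chain of subsets of a finite set stalls, so R = L_T is closed
-- under arcs of D∖𝓑 with head in B.  Suppose w ∈ B were not reached and put
-- X = B ∖ R ≠ ∅.  Every arc of D∖𝓑 entering X then enters B, so ϱ(X) ≤ ϱ(B);
-- X misses V₀ while B meets it, so missing(X) > missing(B).  Since B is tight,
--   missing(X) ≤ ϱ(X) ≤ ϱ(B) = missing(B) < missing(X),
-- contradicting the hypothesis of the theorem for X.

open import Defs
open import Data.Nat using (ℕ; zero; suc; _≥_; _≤_; _<_; z≤n; s≤s)
open import Data.Nat.Properties using (≤-refl; ≤-reflexive; ≤-trans; +-mono-≤; +-suc; 1+n≰n; <-irrefl; module ≤-Reasoning)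
open import Data.Fin using (Fin; zero; suc; inject₁; fromℕ; _≟_)
open import Data.Fin.Relation.Unary.Top using (View; view; ‵fromℕ; ‵inj₁; view-fromℕ; view-inject₁)
open import Data.Bool using (true; false; _∧_; _∨_; not; if_then_else_)
open import Data.Bool.Properties using (T-≡)
open import Data.Product using (Σ; ∃; _×_; _,_; proj₁; proj₂)
open import Data.Sum using (_⊎_; inj₁; inj₂)
open import Data.Empty using (⊥-elim)
open import Function using (_∘_)
open import Function.Bundles using (Equivalence)
open import Function.Definitions using (Injective)
open import Relation.Binary.PropositionalEquality using (_≡_; _≢_; refl; sym; trans; cong; module ≡-Reasoning)
open import Relation.Nullary using (¬_; yes; no)
open import Relation.Nullary.Decidable using (toWitness)

∧-true : ∀ {a b} → a ∧ b ≡ true → a ≡ true × b ≡ true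
∧-true {true} h = refl , h

∧-intro : ∀ {a b} → a ≡ true → b ≡ true → a ∧ b ≡ true
∧-intro refl refl = refl

∨-true : ∀ {a b} → a ∨ b ≡ true → a ≡ true ⊎ b ≡ true
∨-true {true}  _ = inj₁ refl
∨-true {false} h = inj₂ h

∨-introˡ : ∀ {a b} → a ≡ true → a ∨ b ≡ true
∨-introˡ refl = refl

∨-introʳ : ∀ {a b} → b ≡ true → a ∨ b ≡ true
∨-introʳ {true}  _ = refl
∨-introʳ {false} h = h

not-true : ∀ {b} → not b ≡ true → b ≡ false
not-true {false} _ = refl

not-false : ∀ {b} → b ≡ false → not b ≡ true
not-false refl = refl

bool-absurd : ∀ {A : Set} {b} → b ≡ true → b ≡ false → A
bool-absurd refl ()

==-sound : ∀ {k} {x y : Fin k} → (x == y) ≡ true → x ≡ y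
==-sound h = toWitness (Equivalence.from T-≡ h)

==-refl : ∀ {k} (x : Fin k) → (x == x) ≡ true
==-refl x with x ≟ x
... | yes _  = refl
... | no x≢x = ⊥-elim (x≢x refl)

_⊆_ : ∀ {k} → Subset k → Subset k → Set
P ⊆ Q = ∀ i → i ∈ₛ P → i ∈ₛ Q

_∖_ : ∀ {k} → Subset k → Subset k → Subset k
(P ∖ Q) i = P i ∧ not (Q i)

∖-intro : ∀ {k} {P Q : Subset k} {i} → i ∈ₛ P → Q i ≡ false → i ∈ₛ (P ∖ Q)
∖-intro p q = ∧-intro p (not-false q)

∖-elim : ∀ {k} {P Q : Subset k} {i} → i ∈ₛ (P ∖ Q) → i ∈ₛ P × Q i ≡ false
∖-elim h with ∧-true h
... | p , q = p , not-true q

∖-outside : ∀ {k} {P Q : Subset k} {i} → (P ∖ Q) i ≡ false → ¬ i ∈ₛ Q → P i ≡ false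
∖-outside {P = P} {Q} {i} h i∉Q with P i | Q i
... | false | _     = refl
... | true  | true  = ⊥-elim (i∉Q refl)

anyF-intro : ∀ {k} (P : Subset k) (i : Fin k) → i ∈ₛ P → anyF P ≡ true
anyF-intro P zero    h = ∨-introˡ h
anyF-intro P (suc i) h = ∨-introʳ {P zero} (anyF-intro (P ∘ suc) i h)

anyF-elim : ∀ {k} (P : Subset k) → anyF P ≡ true → ∃ λ i → i ∈ₛ P
anyF-elim {suc k} P h with ∨-true {P zero} h
... | inj₁ p = zero , p
... | inj₂ q with anyF-elim (P ∘ suc) q
...   | i , p = suc i , p

anyF-none : ∀ {k} (P : Subset k) → (∀ i → ¬ i ∈ₛ P) → anyF P ≡ false
anyF-none P none with anyF P in e
... | false = refl
... | true with anyF-elim P e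
...   | i , p = ⊥-elim (none i p)

⊆-dec : ∀ {k} (P Q : Subset k) → P ⊆ Q ⊎ ∃ λ i → i ∈ₛ P × Q i ≡ false
⊆-dec {zero}  P Q = inj₁ λ ()
⊆-dec {suc k} P Q with P zero in p | Q zero in q | ⊆-dec (P ∘ suc) (Q ∘ suc)
... | true  | false | _               = inj₂ (zero , p , q)
... | _     | _     | inj₂ (i , pi , qi) = inj₂ (suc i , pi , qi)
... | true  | true  | inj₁ sub = inj₁ λ { zero _ → q ; (suc i) → sub i }
... | false | _     | inj₁ sub = inj₁ λ { zero h → bool-absurd h p ; (suc i) → sub i }

private
  indicator-mono : ∀ {k} (P Q : Subset (suc k)) → (zero ∈ₛ P → zero ∈ₛ Q) →
    (if P zero then 1 else 0) ≤ (if Q zero then 1 else 0)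
  indicator-mono P Q h with P zero | Q zero
  ... | true  | true  = ≤-refl
  ... | true  | false = bool-absurd (h refl) refl
  ... | false | _     = z≤n

  indicator≤1 : ∀ {k} (P : Subset (suc k)) → (if P zero then 1 else 0) ≤ 1
  indicator≤1 P with P zero
  ... | true  = ≤-refl
  ... | false = z≤n

count-mono : ∀ {k} {P Q : Subset k} → P ⊆ Q → count P ≤ count Q
count-mono {zero}          sub = z≤n
count-mono {suc k} {P} {Q} sub =
  +-mono-≤ (indicator-mono P Q (sub zero)) (count-mono (sub ∘ suc))

count-strict : ∀ {k} {P Q : Subset k} → P ⊆ Q →
  (j : Fin k) → P j ≡ false → j ∈ₛ Q → count P < count Q
count-strict {suc k} {P} {Q} sub zero pj qj with P zero | Q zero
count-strict {suc k} sub zero refl refl | false | true = s≤s (count-mono (sub ∘ suc))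
count-strict {suc k} {P} {Q} sub (suc j) pj qj =
  ≤-trans (≤-reflexive (sym (+-suc _ _)))
    (+-mono-≤ (indicator-mono P Q (sub zero)) (count-strict (sub ∘ suc) j pj qj))

count-bound : ∀ {k} (P : Subset k) → count P ≤ k
count-bound {zero}  P = z≤n
count-bound {suc k} P = +-mono-≤ (indicator≤1 P) (count-bound (P ∘ suc))

-- An increasing chain of subsets of Fin n cannot grow n+1 times in a row,
-- so at some stage T it stalls: Y (T+1) ⊆ Y T.
chain-stalls : ∀ {n} (Y : ℕ → Subset n) → (∀ t → Y t ⊆ Y (suc t)) →
  ∃ λ T → Y (suc T) ⊆ Y T
chain-stalls {n} Y increasing with grows (suc n)
  where
  grows : ∀ t → (∃ λ T → Y (suc T) ⊆ Y T) ⊎ t ≤ count (Y t)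
  grows zero = inj₂ z≤n
  grows (suc t) with grows t
  ... | inj₁ stall = inj₁ stall
  ... | inj₂ t≤ with ⊆-dec (Y (suc t)) (Y t)
  ...   | inj₁ stall               = inj₁ (t , stall)
  ...   | inj₂ (v , v∈new , v∉old) = inj₂ (≤-trans (s≤s t≤) (count-strict (increasing t) v v∉old v∈new))
... | inj₁ stall = stall
... | inj₂ big   = ⊥-elim (1+n≰n (≤-trans big (count-bound (Y (suc n)))))

snoc : ∀ {A : Set} {l} → (Fin l → A) → A → Fin (suc l) → A
snoc {A} {l} f a i = byView (view i)
  where
  byView : {i : Fin (suc l)} → View i → A
  byView ‵fromℕ              = a
  byView (‵inj₁ {i = j} _) = f j

snoc-old : ∀ {A : Set} {l} (f : Fin l → A) a (j : Fin l) → snoc f a (inject₁ j) ≡ f j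
snoc-old f a j rewrite view-inject₁ j = refl

snoc-new : ∀ {A : Set} {l} (f : Fin l → A) a → snoc f a (fromℕ l) ≡ a
snoc-new {l = l} f a rewrite view-fromℕ l = refl

top-elim : ∀ {l} (P : Fin (suc l) → Set) → P (fromℕ l) → (∀ j → P (inject₁ j)) → ∀ i → P i
top-elim P last old i with view i
... | ‵fromℕ            = last
... | ‵inj₁ {i = j} _ = old j

snoc-all : ∀ {A : Set} {l} (Q : A → Set) {f : Fin l → A} {a} →
  (∀ j → Q (f j)) → Q a → ∀ i → Q (snoc f a i)
snoc-all Q {f} {a} old new i with view i
... | ‵fromℕ            = new
... | ‵inj₁ {i = j} _ = old j

snoc-injective : ∀ {A : Set} {l} {f : Fin l → A} {a} →
  Injective _≡_ _≡_ f → (∀ j → f j ≢ a) → Injective _≡_ _≡_ (snoc f a)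
snoc-injective inj fresh {x} {y} eq with view x | view y
... | ‵fromℕ | ‵fromℕ = refl
... | ‵inj₁ {i = i} _ | ‵inj₁ {i = j} _ = cong inject₁ (inj eq)
... | ‵inj₁ {i = i} _ | ‵fromℕ = ⊥-elim (fresh i eq)
... | ‵fromℕ | ‵inj₁ {i = j} _ = ⊥-elim (fresh j (sym eq))

module Cuts (D : Digraph) {k : ℕ} (𝓑 : Branchings D k) where
  open Digraph D
  open Branchings 𝓑

  entering : Subset n → Subset m
  entering X a = restArcs D 𝓑 a ∧ (X (head a) ∧ not (X (tail a)))

  entering-elim : ∀ {X a} → a ∈ₛ entering X →
    a ∈ₛ restArcs D 𝓑 × head a ∈ₛ X × X (tail a) ≡ false
  entering-elim h with ∧-true h
  ... | rest , into with ∧-true into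
  ...   | hd , tl = rest , hd , not-true tl

  entering-intro : ∀ {X a} → a ∈ₛ restArcs D 𝓑 → head a ∈ₛ X → X (tail a) ≡ false →
    a ∈ₛ entering X
  entering-intro rest hd tl = ∧-intro rest (∧-intro hd (not-false tl))

  ϱ-mono : ∀ {X Y} → entering X ⊆ entering Y → ϱ D 𝓑 X ≤ ϱ D 𝓑 Y
  ϱ-mono = count-mono

  avoiding : Subset n → Subset k
  avoiding X i = not (anyF (λ v → Vb i v ∧ X v))

  avoiding-intro : ∀ {X i} → (∀ u → u ∈ₛ Vb i → ¬ u ∈ₛ X) → i ∈ₛ avoiding X
  avoiding-intro disjoint =
    not-false (anyF-none _ λ u h → let (u∈Vi , u∈X) = ∧-true h in disjoint u u∈Vi u∈X)

  avoiding-elim : ∀ {X i} → i ∈ₛ avoiding X → ∀ u → u ∈ₛ Vb i → ¬ u ∈ₛ X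
  avoiding-elim h u u∈Vi u∈X = bool-absurd (anyF-intro _ u (∧-intro u∈Vi u∈X)) (not-true h)

  missing-grows : ∀ {X Y} → X ⊆ Y → (i : Fin k) (v : Fin n) → v ∈ₛ Vb i → v ∈ₛ Y →
    (∀ u → u ∈ₛ Vb i → ¬ u ∈ₛ X) → missing D 𝓑 Y < missing D 𝓑 X
  missing-grows {X} {Y} X⊆Y i v v∈Vi v∈Y Vi∩X=∅ =
    count-strict avoiding-anti i Vi-meets-Y (avoiding-intro Vi∩X=∅)
    where
    avoiding-anti : avoiding Y ⊆ avoiding X
    avoiding-anti j h = avoiding-intro λ u u∈Vj u∈X → avoiding-elim h u u∈Vj (X⊆Y u u∈X)
    Vi-meets-Y : avoiding Y i ≡ false
    Vi-meets-Y = cong not (anyF-intro _ v (∧-intro v∈Vi v∈Y))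

module Paths (D : Digraph) {k : ℕ} (𝓑 : Branchings D (suc k)) (B : Subset (Digraph.n D)) where
  open Digraph D
  open Branchings 𝓑

  vertices : ∀ {w} (p : PathIn D 𝓑 B w) → Fin (suc (PathIn.len p)) → Fin n
  vertices p = Walk.verts (PathIn.walk p)

  trivialPath : ∀ {v} → v ∈ₛ Vb zero → v ∈ₛ B → PathIn D 𝓑 B v
  trivialPath {v} v∈V₀ v∈B = record
    { len       = 0
    ; walk      = record { verts = λ _ → v ; arcs = λ () ; arcTail = λ () ; arcHead = λ () ; arcsIn = λ () }
    ; simple    = λ { {zero} {zero} _ → refl }
    ; inB       = λ _ → v∈B
    ; start     = v∈V₀
    ; startOnly = λ { zero 0≢0 → ⊥-elim (0≢0 refl) }
    ; end       = refl
    }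

  extendPath : ∀ {u v} (p : PathIn D 𝓑 B u) (a : Fin m) → a ∈ₛ restArcs D 𝓑 →
    tail a ≡ u → head a ≡ v → v ∈ₛ B → ¬ v ∈ₛ Vb zero →
    (∀ j → vertices p j ≢ v) → PathIn D 𝓑 B v
  extendPath {u} {v} p a a∈rest a-from-u a-to-v v∈B v∉V₀ fresh = record
    { len       = suc len
    ; walk      = record
      { verts   = snoc verts v
      ; arcs    = snoc arcs a
      ; arcTail = arcTail′
      ; arcHead = arcHead′
      ; arcsIn  = snoc-all (_∈ₛ restArcs D 𝓑) arcsIn a∈rest
      }
    ; simple    = snoc-injective simple fresh
    ; inB       = snoc-all (_∈ₛ B) inB v∈B
    ; start     = trans (cong (Vb zero) (snoc-old verts v zero)) start
    ; startOnly = startOnly′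
    ; end       = snoc-new verts v
    }
    where
    open PathIn p
    open Walk walk
    open ≡-Reasoning
    arcTail′ : ∀ i → tail (snoc arcs a i) ≡ snoc verts v (inject₁ i)
    arcTail′ = top-elim (λ i → tail (snoc arcs a i) ≡ snoc verts v (inject₁ i))
      (begin
        tail (snoc arcs a (fromℕ len))  ≡⟨ cong tail (snoc-new arcs a) ⟩
        tail a                           ≡⟨ a-from-u ⟩
        u                                ≡⟨ sym end ⟩
        verts (fromℕ len)                ≡⟨ sym (snoc-old verts v (fromℕ len)) ⟩
        snoc verts v (inject₁ (fromℕ len)) ∎)
      (λ j → begin
        tail (snoc arcs a (inject₁ j))  ≡⟨ cong tail (snoc-old arcs a j) ⟩
        tail (arcs j)                    ≡⟨ arcTail j ⟩
        verts (inject₁ j)                ≡⟨ sym (snoc-old verts v (inject₁ j)) ⟩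
        snoc verts v (inject₁ (inject₁ j)) ∎)
    arcHead′ : ∀ i → head (snoc arcs a i) ≡ snoc verts v (suc i)
    arcHead′ = top-elim (λ i → head (snoc arcs a i) ≡ snoc verts v (suc i))
      (begin
        head (snoc arcs a (fromℕ len))  ≡⟨ cong head (snoc-new arcs a) ⟩
        head a                           ≡⟨ a-to-v ⟩
        v                                ≡⟨ sym (snoc-new verts v) ⟩
        snoc verts v (fromℕ (suc len))   ∎)
      (λ j → begin
        head (snoc arcs a (inject₁ j))  ≡⟨ cong head (snoc-old arcs a j) ⟩
        head (arcs j)                    ≡⟨ arcHead j ⟩
        verts (suc j)                    ≡⟨ sym (snoc-old verts v (suc j)) ⟩
        snoc verts v (inject₁ (suc j))   ∎)
    startOnly′ : ∀ i → i ≢ zero → ¬ snoc verts v i ∈ₛ Vb zero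
    startOnly′ i i≢0 with view i
    ... | ‵fromℕ            = v∉V₀
    ... | ‵inj₁ {i = j} _ = startOnly j (i≢0 ∘ cong inject₁)

module Layers (D : Digraph) {k : ℕ} (𝓑 : Branchings D (suc k)) (B : Subset (Digraph.n D)) where
  open Digraph D
  open Branchings 𝓑
  open Paths D 𝓑 B
  open Cuts D 𝓑

  rest : Subset m
  rest = restArcs D 𝓑

  arcsInto : Subset n → Fin n → Subset m
  arcsInto S v a = rest a ∧ ((head a == v) ∧ S (tail a))

  layer : ℕ → Subset n
  layer zero    v = Vb zero v ∧ B v
  layer (suc t) v = layer t v ∨ (B v ∧ anyF (arcsInto (layer t) v))

  layer-grows : ∀ t → layer t ⊆ layer (suc t)
  layer-grows t v = ∨-introˡ

  base⊆layer : ∀ t → layer zero ⊆ layer t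
  base⊆layer zero    v h = h
  base⊆layer (suc t) v h = layer-grows t v (base⊆layer t v h)

  layer-closed : ∀ t a → a ∈ₛ rest → tail a ∈ₛ layer t → head a ∈ₛ B →
    head a ∈ₛ layer (suc t)
  layer-closed t a a∈rest tail∈ head∈B = ∨-introʳ {layer t (head a)}
    (∧-intro head∈B (anyF-intro _ a (∧-intro a∈rest (∧-intro (==-refl (head a)) tail∈))))

  layer-new : ∀ t v → v ∈ₛ layer (suc t) →
    v ∈ₛ layer t ⊎ (layer t v ≡ false × v ∈ₛ B ×
      ∃ λ a → a ∈ₛ rest × head a ≡ v × tail a ∈ₛ layer t)
  layer-new t v h with layer t v in old
  ... | true  = inj₁ refl
  ... | false with ∧-true h
  ...   | v∈B , entered with anyF-elim _ entered
  ...     | a , a-into with ∧-true a-into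
  ...       | a∈rest , rest′ with ∧-true rest′
  ...         | a-to-v , tail∈ = inj₂ (refl , v∈B , a , a∈rest , ==-sound a-to-v , tail∈)

  -- Every vertex of layer t is the end of a path all of whose vertices lie in
  -- layer t; a new vertex is appended to such a path, hence is not on it.
  pathsTo : ∀ t v → v ∈ₛ layer t →
    Σ (PathIn D 𝓑 B v) λ p → ∀ j → vertices p j ∈ₛ layer t
  pathsTo zero v h with ∧-true {Vb zero v} h
  ... | v∈V₀ , v∈B = trivialPath v∈V₀ v∈B , λ _ → h
  pathsTo (suc t) v h with layer-new t v h
  ... | inj₁ v∈old with pathsTo t v v∈old
  ...   | p , inside = p , λ j → layer-grows t _ (inside j)
  pathsTo (suc t) v h | inj₂ (v∉old , v∈B , a , a∈rest , a-to-v , tail∈) with pathsTo t (tail a) tail∈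
  ...   | p , inside =
    extendPath p a a∈rest refl a-to-v v∈B v∉V₀ fresh ,
    snoc-all (_∈ₛ layer (suc t)) (λ j → layer-grows t _ (inside j)) h
    where
    fresh : ∀ j → vertices p j ≢ v
    fresh j refl = bool-absurd (inside j) v∉old
    v∉V₀ : ¬ v ∈ₛ Vb zero
    v∉V₀ v∈V₀ = bool-absurd (base⊆layer t v (∧-intro v∈V₀ v∈B)) v∉old

  stalled : ∃ λ T → layer (suc T) ⊆ layer T
  stalled = chain-stalls layer layer-grows

  reached : Subset n
  reached = layer (proj₁ stalled)

  pathTo : ∀ v → v ∈ₛ reached → PathIn D 𝓑 B v
  pathTo v h = proj₁ (pathsTo (proj₁ stalled) v h)

  reached-closed : ∀ a → a ∈ₛ rest → tail a ∈ₛ reached → head a ∈ₛ B → head a ∈ₛ reached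
  reached-closed a a∈rest tail∈R head∈B =
    proj₂ stalled (head a) (layer-closed (proj₁ stalled) a a∈rest tail∈R head∈B)

  unreached : Subset n
  unreached = B ∖ reached

  unreached-intro : ∀ {v} → v ∈ₛ B → reached v ≡ false → v ∈ₛ unreached
  unreached-intro = ∖-intro {P = B} {Q = reached}

  unreached-elim : ∀ {v} → v ∈ₛ unreached → v ∈ₛ B × reached v ≡ false
  unreached-elim = ∖-elim {P = B} {Q = reached}

  unreached⊆B : unreached ⊆ B
  unreached⊆B u u∈X = proj₁ (unreached-elim u∈X)

  -- By closedness, every arc of D∖𝓑 entering B ∖ R comes from outside B.
  unreached-entering : entering unreached ⊆ entering B
  unreached-entering a h with entering-elim {unreached} h
  ... | a∈rest , head∈X , tail∉X with unreached-elim head∈X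
  ...   | head∈B , head∉R = entering-intro {B} a∈rest head∈B tail∉B
    where
    tail∉B : B (tail a) ≡ false
    tail∉B = ∖-outside {P = B} {Q = reached} tail∉X
      (λ tail∈R → bool-absurd (reached-closed a a∈rest tail∈R head∈B) head∉R)

  -- V₀ ∩ B is the first layer, so B ∖ R avoids V₀.
  unreached-avoids-V₀ : ∀ u → u ∈ₛ Vb zero → ¬ u ∈ₛ unreached
  unreached-avoids-V₀ u u∈V₀ u∈X with unreached-elim u∈X
  ... | u∈B , u∉R = bool-absurd (base⊆layer (proj₁ stalled) u (∧-intro u∈V₀ u∈B)) u∉R

proposition2 : (D : Digraph) (k : ℕ) (𝓑 : Branchings D (suc k)) →
    (∀ X → Nonempty D 𝓑 X → ϱ D 𝓑 X ≥ missing D 𝓑 X) →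
    (B : Subset (Digraph.n D)) → Dangerous D 𝓑 B →
    (w : Fin (Digraph.n D)) → w ∈ₛ B → PathIn D 𝓑 B w
proposition2 D k 𝓑 cut-condition B ((_ , B-tight) , v₀ , v₀∈V₀ , v₀∈B) w w∈B
  with Layers.reached D 𝓑 B w in w∈R
... | true  = Layers.pathTo D 𝓑 B w w∈R
... | false = ⊥-elim (<-irrefl refl (begin-strict
      missing D 𝓑 X  ≤⟨ cut-condition X (w , unreached-intro w∈B w∈R) ⟩
      ϱ D 𝓑 X        ≤⟨ ϱ-mono {X} {B} unreached-entering ⟩
      ϱ D 𝓑 B        ≡⟨ B-tight ⟩
      missing D 𝓑 B  <⟨ missing-grows unreached⊆B zero v₀ v₀∈V₀ v₀∈B unreached-avoids-V₀ ⟩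
      missing D 𝓑 X  ∎))
  where
  open Layers D 𝓑 B
  open Cuts D 𝓑
  open ≤-Reasoning
  X : Subset (Digraph.n D)
  X = unreached
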